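{- Fix a $4$-cycle $T$ (a set of four lines $\{a,b\},\{b,c\},\{c,d\},\{d,a\}$ with $a,b,c,d\in P$ distinct). The number of connected proper line complexes on the $8$-point set $P$ that contain $T$, have $T$ as their unique $4$-cycle, and in which exactly three of the four vertices $a,b,c,d$ of $T$ have valence greater than $2$, is $432$.
   Context: $P$ is a set of $8$ points (the points of $\mathbb F_2^3$). A line is a $2$-element subset of $P$. A line complex is a set of exactly $8$ distinct lines. $\mathcal C$ omits $p$ if no line of $\mathcal C$ contains $p$. Viewing $\mathcal C$ as a graph with vertex set $P$ and edge set $\mathcal C$, an isolated tree is a connected component containing at least one line which is a tree; $\mathcal C$ is connected if this graph is connected. A complex is proper if it omits no point and has no isolated tree. The valence of a point is the number of lines of $\mathcal C$ containing it. A $4$-cycle is a set of $4$ lines $\{p_1,p_2\},\{p_2,p_3\},\{p_3,p_4\},\{p_4,p_1\}$ with $p_i$ distinct. -}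

module Defs where

open import Data.Nat as ℕ using (ℕ; _<_; _≥_)
open import Data.Fin as Fin using (Fin)
open import Data.Fin.Properties using (_≟_)
open import Data.Fin.Subset using (Subset; _∈_; ∣_∣; _∩_)
open import Data.Bool using (Bool; _∨_)
open import Data.List as List using (List; []; _∷_; length; filter; allFin; concatMap; map; lookup)
open import Data.List.Relation.Unary.Unique.Propositional using (Unique)
open import Data.Vec using (tabulate)
open import Data.Product using (Σ; ∃; ∃-syntax; _×_; _,_; proj₁; proj₂)
open import Data.Sum using (_⊎_)
open import Relation.Binary.PropositionalEquality using (_≡_; _≢_)
open import Relation.Nullary using (¬_)
open import Relation.Nullary.Decidable using (⌊_⌋)
import Data.List.Membership.Propositional as LMem

-- Points: the 8 points of F_2^3, encoded as Fin 8 (only the set matters).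

Point : Set
Point = Fin 8

-- Lines: 2-element subsets {i,j} of P, each listed once as (i , j) with i < j.

lineList : List (Point × Point)
lineList = concatMap (λ i → map (i ,_) (filter (λ j → Fin._<?_ i j) (allFin 8))) (allFin 8)

nLines : ℕ
nLines = length lineList      -- = 28

LineIx : Set
LineIx = Fin nLines

ends : LineIx → Point × Point
ends k = lookup lineList k

Joins : LineIx → Point → Point → Set
Joins k p q = (ends k ≡ (p , q)) ⊎ (ends k ≡ (q , p))

Incident : LineIx → Point → Set
Incident k p = (proj₁ (ends k) ≡ p) ⊎ (proj₂ (ends k) ≡ p)

incident? : LineIx → Point → Bool
incident? k p = ⌊ proj₁ (ends k) ≟ p ⌋ ∨ ⌊ proj₂ (ends k) ≟ p ⌋

LineSet : Set
LineSet = Subset nLines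

IsLineComplex : LineSet → Set
IsLineComplex C = ∣ C ∣ ≡ 8

Adj : LineSet → Point → Point → Set
Adj C p q = ∃[ k ] (k ∈ C × Joins k p q)

Omits : LineSet → Point → Set
Omits C p = ∀ k → k ∈ C → ¬ Incident k p

star : Point → LineSet
star p = tabulate (λ k → incident? k p)

valence : LineSet → Point → ℕ
valence C p = ∣ C ∩ star p ∣

data Reach (C : LineSet) (p : Point) : Point → Set where
  here : Reach C p p
  step : ∀ {q r} → Reach C p q → Adj C q r → Reach C p r

Connected : LineSet → Set
Connected C = ∀ p q → Reach C p q

data Path (C : LineSet) : List Point → Set where
  nil  : Path C []
  one  : ∀ p → Path C (p ∷ [])
  cons : ∀ p q vs → Adj C p q → Path C (q ∷ vs) → Path C (p ∷ q ∷ vs)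

record Cycle (C : LineSet) : Set where
  field
    first  : Point
    rest   : List Point
    last   : Point
    long   : length rest ≥ 1
    distinct : Unique (first ∷ rest List.++ (last ∷ []))
    path   : Path C (first ∷ rest List.++ (last ∷ []))
    closes : Adj C last first

-- the connected component of v contains at least one line of C and
-- is a tree (connected by definition, and acyclic: no cycle of C
-- meets it -- a cycle meeting the component lies inside it)
IsolatedTree : LineSet → Set
IsolatedTree C =
  ∃[ v ] ((∃[ w ] (Reach C v w × ∃[ k ] (k ∈ C × Incident k w)))
         × ¬ (Σ (Cycle C) λ cyc → Reach C v (Cycle.first cyc)))

Proper : LineSet → Set
Proper C = (∀ p → ¬ Omits C p) × ¬ IsolatedTree C

OnSquare : Point → Point → Point → Point → LineIx → Set
OnSquare p₁ p₂ p₃ p₄ k = Joins k p₁ p₂ ⊎ Joins k p₂ p₃ ⊎ Joins k p₃ p₄ ⊎ Joins k p₄ p₁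

Distinct4 : Point → Point → Point → Point → Set
Distinct4 p₁ p₂ p₃ p₄ =
  p₁ ≢ p₂ × p₁ ≢ p₃ × p₁ ≢ p₄ × p₂ ≢ p₃ × p₂ ≢ p₄ × p₃ ≢ p₄

ContainsSquare : LineSet → Point → Point → Point → Point → Set
ContainsSquare C p₁ p₂ p₃ p₄ =
  Distinct4 p₁ p₂ p₃ p₄ × (∀ k → OnSquare p₁ p₂ p₃ p₄ k → k ∈ C)

UniqueSquare : LineSet → Point → Point → Point → Point → Set
UniqueSquare C a b c d =
  ContainsSquare C a b c d ×
  (∀ p₁ p₂ p₃ p₄ → ContainsSquare C p₁ p₂ p₃ p₄ →
     ∀ k → (OnSquare p₁ p₂ p₃ p₄ k → OnSquare a b c d k)
         × (OnSquare a b c d k → OnSquare p₁ p₂ p₃ p₄ k))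

ExactlyThreeHigh : LineSet → Point → Point → Point → Point → Set
ExactlyThreeHigh C a b c d =
  length (filter (λ p → 2 ℕ.<? valence C p) (a ∷ b ∷ c ∷ d ∷ [])) ≡ 3

Counted : Point → Point → Point → Point → LineSet → Set
Counted a b c d C =
  IsLineComplex C × Connected C × Proper C
  × UniqueSquare C a b c d × ExactlyThreeHigh C a b c d

HasCount : (LineSet → Set) → ℕ → Set
HasCount Q n =
  Σ (List LineSet) λ L → Unique L × (∀ C → (C LMem.∈ L → Q C) × (Q C → C LMem.∈ L)) × length L ≡ n

-- A permutation of the eight points acts on lines and on line complexes and preserves every
-- notion in the statement: size, connectivity, omitted points, isolated trees, 4-cycles and
-- valences. Any 4-cycle a b c d is the image of the square 0 1 2 3 under some permutation, so
-- it suffices to count for that square. That count is a finite computation: the 8-line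
-- complexes containing the square with no omitted point and exactly three of 0, 1, 2, 3 of
-- valence > 2 are enumerated, with their valences accumulated along the way; 432 of them are
-- connected, each of those has the square as its only 4-cycle, and a connected complex with a
-- cycle has no isolated tree.

module Submission where

open import Defs
import Algebra.Properties.CommutativeMonoid.Sum as MonoidSum
open import Data.Bool using (Bool; true; false; _∧_; _∨_; if_then_else_; T)
import Data.Bool.Properties as Bool
open import Data.Bool.ListAction using (all)
open import Data.Fin using (Fin; zero; suc; #_)
open import Data.Fin.Patterns using (0F; 1F; 2F; 3F; 4F; 5F; 6F; 7F)
open import Data.Fin.Permutation
  using (Permutation′; permutation; _⟨$⟩ʳ_; _⟨$⟩ˡ_; inverseˡ; inverseʳ; flip; transpose; _∘ₚ_)
import Data.Fin.Permutation as Permutation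
open import Data.Fin.Properties using (_≟_; all?)
open import Data.Fin.Subset using (Subset; _∈_; _⊆_; ∣_∣; _∩_; inside; outside; ⁅_⁆; ⊤)
open import Data.Fin.Subset.Properties
  using (s⊆s; out⊆; drop-∷-⊆; Empty-unique; ∣⊥∣≡0; x∈p∩q⁺; x∈p∩q⁻) renaming (_∈?_ to _∈ₛ?_)
open import Data.List using (List; []; _∷_; _++_; length; filter; allFin; map)
import Data.List.Properties as List
open import Data.List.Membership.Propositional using () renaming (_∈_ to _∈ₗ_)
import Data.List.Membership.Propositional.Properties as Membership
import Data.List.Membership.DecPropositional as DecMembership
import Data.List.Relation.Binary.Subset.DecPropositional as DecListSubset
open import Data.List.Relation.Unary.All using (All)
import Data.List.Relation.Unary.All as All
import Data.List.Relation.Unary.All.Properties as All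
import Data.List.Relation.Unary.AllPairs as AllPairs
open import Data.List.Relation.Unary.Any using (here; there)
open import Data.List.Relation.Unary.Unique.Propositional using (Unique)
import Data.List.Relation.Unary.Unique.Propositional.Properties as Unique
open import Data.Nat as ℕ using (ℕ; zero; suc; _+_)
open import Data.Nat.GeneralisedArithmetic using (iterate)
import Data.Nat.Properties as ℕ
open import Data.Product as Product using (Σ; ∃-syntax; _×_; _,_; proj₁; proj₂)
open import Data.Product.Properties using (≡-dec)
open import Data.Sum as Sum using (_⊎_; inj₁; inj₂)
open import Data.Vec as Vec using (Vec; []; _∷_; lookup; tabulate; updateAt; replicate; _[_]≔_)
import Data.Vec.Properties as Vec
open import Function using (_∘_; id; _⇔_; mk⇔; Equivalence)
open import Relation.Binary.PropositionalEquality
open import Relation.Nullary using (¬_; Dec; does; yes; no; ¬?; contradiction)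
open import Relation.Nullary.Decidable
  using (toWitness; _⊎-dec_; _×-dec_; _→-dec_; dec-true; dec-false; does-⇔; isYes≗does; ⌊_⌋)
open import Relation.Unary using (Decidable)

does≡true⇒ : ∀ {A : Set} (a? : Dec A) → does a? ≡ true → A
does≡true⇒ (yes a) _ = a

∨≡true⇒ : ∀ {x y} → x ∨ y ≡ true → x ≡ true ⊎ y ≡ true
∨≡true⇒ {true} _ = inj₁ refl
∨≡true⇒ {false} y≡true = inj₂ y≡true

lookup-extensional : ∀ {A : Set} {n} {u v : Vec A n} → (∀ k → lookup u k ≡ lookup v k) → u ≡ v
lookup-extensional {u = u} {v} u≗v = begin
  u                  ≡⟨ Vec.tabulate∘lookup u ⟨
  tabulate (lookup u) ≡⟨ Vec.tabulate-cong u≗v ⟩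
  tabulate (lookup v) ≡⟨ Vec.tabulate∘lookup v ⟩
  v                  ∎
  where open ≡-Reasoning

indicator : Bool → ℕ
indicator b = if b then 1 else 0

module ℕSum = MonoidSum ℕ.+-0-commutativeMonoid

∣_∣≡∑ : ∀ {n} (v : Subset n) → ∣ v ∣ ≡ ℕSum.sum (indicator ∘ lookup v)
∣ [] ∣≡∑ = refl
∣ inside ∷ v ∣≡∑ = cong suc ∣ v ∣≡∑
∣ outside ∷ v ∣≡∑ = ∣ v ∣≡∑

∈⇒∣∣≢0 : ∀ {n} {x : Fin n} {s : Subset n} → x ∈ s → ∣ s ∣ ≢ 0
∈⇒∣∣≢0 Vec.here ()
∈⇒∣∣≢0 {s = inside ∷ s} (Vec.there x∈s) ()
∈⇒∣∣≢0 {s = outside ∷ s} (Vec.there x∈s) = ∈⇒∣∣≢0 x∈s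

length-filter-map : ∀ {A B : Set} {P : B → Set} {Q : A → Set} (P? : Decidable P) (Q? : Decidable Q) (f : A → B) →
  (∀ x → P (f x) ⇔ Q x) → ∀ xs → length (filter P? (map f xs)) ≡ length (filter Q? xs)
length-filter-map P? Q? f P∘f⇔Q [] = refl
length-filter-map P? Q? f P∘f⇔Q (x ∷ xs) with P? (f x) | Q? x
... | yes _  | yes _ = cong suc (length-filter-map P? Q? f P∘f⇔Q xs)
... | no _   | no _  = length-filter-map P? Q? f P∘f⇔Q xs
... | yes p  | no ¬q = contradiction (Equivalence.to (P∘f⇔Q x) p) ¬q
... | no ¬p  | yes q = contradiction (Equivalence.from (P∘f⇔Q x) q) ¬p

-- Deciding through the boolean all keeps the evaluation from building the proof terms of All.all?.
all-decided : ∀ {A : Set} {P : A → Set} (P? : Decidable P) xs → T (all (⌊_⌋ ∘ P?) xs) → All P xs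
all-decided P? xs = All.map toWitness ∘ All.all⁺ (⌊_⌋ ∘ P?) xs

permuteSubset : ∀ {n} → Permutation′ n → Subset n → Subset n
permuteSubset ρ v = tabulate (λ k → lookup v (ρ ⟨$⟩ˡ k))

lookup-permuteSubset : ∀ {n} (ρ : Permutation′ n) v k → lookup (permuteSubset ρ v) k ≡ lookup v (ρ ⟨$⟩ˡ k)
lookup-permuteSubset ρ v = Vec.lookup∘tabulate (lookup v ∘ (ρ ⟨$⟩ˡ_))

∈-permuteSubset : ∀ {n} (ρ : Permutation′ n) {v k} → k ∈ v → ρ ⟨$⟩ʳ k ∈ permuteSubset ρ v
∈-permuteSubset ρ {v} {k} k∈v = Vec.lookup⇒[]= _ (permuteSubset ρ v) (begin
  lookup (permuteSubset ρ v) (ρ ⟨$⟩ʳ k) ≡⟨ lookup-permuteSubset ρ v (ρ ⟨$⟩ʳ k) ⟩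
  lookup v (ρ ⟨$⟩ˡ (ρ ⟨$⟩ʳ k))         ≡⟨ cong (lookup v) (inverseˡ ρ) ⟩
  lookup v k                           ≡⟨ Vec.[]=⇒lookup k∈v ⟩
  inside                               ∎)
  where open ≡-Reasoning

permuteSubset-inverse : ∀ {n} (ρ : Permutation′ n) v → permuteSubset (flip ρ) (permuteSubset ρ v) ≡ v
permuteSubset-inverse ρ v = lookup-extensional λ k → begin
  lookup (permuteSubset (flip ρ) (permuteSubset ρ v)) k ≡⟨ lookup-permuteSubset (flip ρ) (permuteSubset ρ v) k ⟩
  lookup (permuteSubset ρ v) (ρ ⟨$⟩ʳ k)                ≡⟨ lookup-permuteSubset ρ v (ρ ⟨$⟩ʳ k) ⟩
  lookup v (ρ ⟨$⟩ˡ (ρ ⟨$⟩ʳ k))                         ≡⟨ cong (lookup v) (inverseˡ ρ) ⟩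
  lookup v k                                           ∎
  where open ≡-Reasoning

permuteSubset-∩ : ∀ {n} (ρ : Permutation′ n) u v → permuteSubset ρ (u ∩ v) ≡ permuteSubset ρ u ∩ permuteSubset ρ v
permuteSubset-∩ ρ u v = lookup-extensional λ k → begin
  lookup (permuteSubset ρ (u ∩ v)) k
    ≡⟨ lookup-permuteSubset ρ (u ∩ v) k ⟩
  lookup (u ∩ v) (ρ ⟨$⟩ˡ k)
    ≡⟨ Vec.lookup-zipWith _∧_ (ρ ⟨$⟩ˡ k) u v ⟩
  lookup u (ρ ⟨$⟩ˡ k) ∧ lookup v (ρ ⟨$⟩ˡ k)
    ≡⟨ cong₂ _∧_ (lookup-permuteSubset ρ u k) (lookup-permuteSubset ρ v k) ⟨
  lookup (permuteSubset ρ u) k ∧ lookup (permuteSubset ρ v) k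
    ≡⟨ Vec.lookup-zipWith _∧_ k (permuteSubset ρ u) (permuteSubset ρ v) ⟨
  lookup (permuteSubset ρ u ∩ permuteSubset ρ v) k
    ∎
  where open ≡-Reasoning

∣permuteSubset∣ : ∀ {n} (ρ : Permutation′ n) v → ∣ permuteSubset ρ v ∣ ≡ ∣ v ∣
∣permuteSubset∣ {n} ρ v = begin
  ∣ permuteSubset ρ v ∣
    ≡⟨ ∣ permuteSubset ρ v ∣≡∑ ⟩
  ℕSum.sum (indicator ∘ lookup (permuteSubset ρ v))
    ≡⟨ ℕSum.sum-cong-≗ {n} (cong indicator ∘ Vec.lookup∘tabulate _) ⟩
  ℕSum.sum (indicator ∘ lookup v ∘ (ρ ⟨$⟩ˡ_))
    ≡⟨ ℕSum.∑-permute (indicator ∘ lookup v) (flip ρ) ⟨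
  ℕSum.sum (indicator ∘ lookup v)
    ≡⟨ ∣ v ∣≡∑ ⟨
  ∣ v ∣
    ∎
  where open ≡-Reasoning

permute-injective : ∀ {n} (π : Permutation′ n) {p q} → π ⟨$⟩ʳ p ≡ π ⟨$⟩ʳ q → p ≡ q
permute-injective π {p} {q} πp≡πq = begin
  p                  ≡⟨ inverseˡ π ⟨
  π ⟨$⟩ˡ (π ⟨$⟩ʳ p) ≡⟨ cong (π ⟨$⟩ˡ_) πp≡πq ⟩
  π ⟨$⟩ˡ (π ⟨$⟩ʳ q) ≡⟨ inverseˡ π ⟩
  q                  ∎
  where open ≡-Reasoning

transpose-left : ∀ {n} (i j : Fin n) → transpose i j ⟨$⟩ʳ i ≡ j
transpose-left i j rewrite dec-true (i ≟ i) refl = refl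

transpose-elsewhere : ∀ {n} {i j k : Fin n} → k ≢ i → k ≢ j → transpose i j ⟨$⟩ʳ k ≡ k
transpose-elsewhere {i = i} {j} {k} k≢i k≢j rewrite dec-false (k ≟ i) k≢i | dec-false (k ≟ j) k≢j = refl

redirect : ∀ {n} → Permutation′ n → Fin n → Fin n → Permutation′ n
redirect π j x = transpose j (π ⟨$⟩ˡ x) ∘ₚ π

redirect-at : ∀ {n} (π : Permutation′ n) j x → redirect π j x ⟨$⟩ʳ j ≡ x
redirect-at π j x = trans (cong (π ⟨$⟩ʳ_) (transpose-left j (π ⟨$⟩ˡ x))) (inverseʳ π)

redirect-keeps : ∀ {n} (π : Permutation′ n) {i j x y} → i ≢ j → π ⟨$⟩ʳ i ≡ y → y ≢ x → redirect π j x ⟨$⟩ʳ i ≡ y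
redirect-keeps π {i} {j} {x} i≢j πi≡y y≢x = trans (cong (π ⟨$⟩ʳ_) (transpose-elsewhere i≢j i≢π⁻¹x)) πi≡y
  where
  i≢π⁻¹x : i ≢ π ⟨$⟩ˡ x
  i≢π⁻¹x i≡π⁻¹x = y≢x (trans (sym πi≡y) (trans (cong (π ⟨$⟩ʳ_) i≡π⁻¹x) (inverseʳ π)))

_≟ₚ_ : (x y : Point × Point) → Dec (x ≡ y)
_≟ₚ_ = ≡-dec _≟_ _≟_

endpointTable : Vec (Point × Point) nLines
endpointTable =
  (0F , 1F) ∷ (0F , 2F) ∷ (0F , 3F) ∷ (0F , 4F) ∷ (0F , 5F) ∷ (0F , 6F) ∷ (0F , 7F) ∷
  (1F , 2F) ∷ (1F , 3F) ∷ (1F , 4F) ∷ (1F , 5F) ∷ (1F , 6F) ∷ (1F , 7F) ∷ (2F , 3F) ∷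
  (2F , 4F) ∷ (2F , 5F) ∷ (2F , 6F) ∷ (2F , 7F) ∷ (3F , 4F) ∷ (3F , 5F) ∷ (3F , 6F) ∷
  (3F , 7F) ∷ (4F , 5F) ∷ (4F , 6F) ∷ (4F , 7F) ∷ (5F , 6F) ∷ (5F , 7F) ∷ (6F , 7F) ∷ []

endpointTable-ends : ∀ k → lookup endpointTable k ≡ ends k
endpointTable-ends = toWitness {a? = all? λ k → lookup endpointTable k ≟ₚ ends k} _

-- Unlike #_, fin evaluates no decision procedure, which matters in the computations below;
-- out-of-range arguments give junk.
fin : ∀ {n} → ℕ → Fin (suc n)
fin zero = zero
fin {zero} (suc k) = zero
fin {suc n} (suc k) = suc (fin k)

-- The diagonal entries are junk.
lineIndexTable : Vec (Vec LineIx 8) 8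
lineIndexTable =
  (fin 0 ∷ fin 0 ∷ fin 1 ∷ fin 2 ∷ fin 3 ∷ fin 4 ∷ fin 5 ∷ fin 6 ∷ []) ∷
  (fin 0 ∷ fin 0 ∷ fin 7 ∷ fin 8 ∷ fin 9 ∷ fin 10 ∷ fin 11 ∷ fin 12 ∷ []) ∷
  (fin 1 ∷ fin 7 ∷ fin 0 ∷ fin 13 ∷ fin 14 ∷ fin 15 ∷ fin 16 ∷ fin 17 ∷ []) ∷
  (fin 2 ∷ fin 8 ∷ fin 13 ∷ fin 0 ∷ fin 18 ∷ fin 19 ∷ fin 20 ∷ fin 21 ∷ []) ∷
  (fin 3 ∷ fin 9 ∷ fin 14 ∷ fin 18 ∷ fin 0 ∷ fin 22 ∷ fin 23 ∷ fin 24 ∷ []) ∷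
  (fin 4 ∷ fin 10 ∷ fin 15 ∷ fin 19 ∷ fin 22 ∷ fin 0 ∷ fin 25 ∷ fin 26 ∷ []) ∷
  (fin 5 ∷ fin 11 ∷ fin 16 ∷ fin 20 ∷ fin 23 ∷ fin 25 ∷ fin 0 ∷ fin 27 ∷ []) ∷
  (fin 6 ∷ fin 12 ∷ fin 17 ∷ fin 21 ∷ fin 24 ∷ fin 26 ∷ fin 27 ∷ fin 0 ∷ []) ∷ []

lineIndex : Point → Point → LineIx
lineIndex p q = lookup (lookup lineIndexTable p) q

joins? : ∀ k p q → Dec (Joins k p q)
joins? k p q = (ends k ≟ₚ (p , q)) ⊎-dec (ends k ≟ₚ (q , p))

Incident? : ∀ k p → Dec (Incident k p)
Incident? k p = (proj₁ (ends k) ≟ p) ⊎-dec (proj₂ (ends k) ≟ p)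

incident?≡does : ∀ k p → incident? k p ≡ does (Incident? k p)
incident?≡does k p = cong₂ _∨_ (isYes≗does (proj₁ (ends k) ≟ p)) (isYes≗does (proj₂ (ends k) ≟ p))

ends-distinct : ∀ k → proj₁ (ends k) ≢ proj₂ (ends k)
ends-distinct = toWitness {a? = all? λ k → ¬? (proj₁ (ends k) ≟ proj₂ (ends k))} _

lineIndex-ends : ∀ k → lineIndex (proj₁ (ends k)) (proj₂ (ends k)) ≡ k
lineIndex-ends = toWitness {a? = all? λ k → lineIndex (proj₁ (ends k)) (proj₂ (ends k)) ≟ k} _

lineIndex-comm : ∀ p q → lineIndex p q ≡ lineIndex q p
lineIndex-comm = toWitness {a? = all? λ p → all? λ q → lineIndex p q ≟ lineIndex q p} _

lineIndex-joins : ∀ p q → p ≢ q → Joins (lineIndex p q) p q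
lineIndex-joins = toWitness {a? = all? λ p → all? λ q → ¬? (p ≟ q) →-dec joins? (lineIndex p q) p q} _

joins⇒≡lineIndex : ∀ {k p q} → Joins k p q → k ≡ lineIndex p q
joins⇒≡lineIndex {k} (inj₁ e) = trans (sym (lineIndex-ends k)) (cong (λ (x , y) → lineIndex x y) e)
joins⇒≡lineIndex {k} {p} {q} (inj₂ e) =
  trans (sym (lineIndex-ends k)) (trans (cong (λ (x , y) → lineIndex x y) e) (lineIndex-comm q p))

joins-sym : ∀ {k p q} → Joins k p q → Joins k q p
joins-sym (inj₁ e) = inj₂ e
joins-sym (inj₂ e) = inj₁ e

joins⇒≢ : ∀ {k p q} → Joins k p q → p ≢ q
joins⇒≢ {k} (inj₁ e) refl = ends-distinct k (trans (cong proj₁ e) (sym (cong proj₂ e)))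
joins⇒≢ {k} (inj₂ e) refl = ends-distinct k (trans (cong proj₁ e) (sym (cong proj₂ e)))

joins⇒incident : ∀ {k p q} → Joins k p q → Incident k p
joins⇒incident (inj₁ e) = inj₁ (cong proj₁ e)
joins⇒incident (inj₂ e) = inj₂ (cong proj₂ e)

incident⇒joins : ∀ {k p} → Incident k p → ∃[ q ] Joins k p q
incident⇒joins {k} (inj₁ refl) = proj₂ (ends k) , inj₁ refl
incident⇒joins {k} (inj₂ refl) = proj₁ (ends k) , inj₂ refl

∈-star⁺ : ∀ {k p} → Incident k p → k ∈ star p
∈-star⁺ {k} {p} k∋p = Vec.lookup⇒[]= k (star p) (begin
  lookup (star p) k        ≡⟨ Vec.lookup∘tabulate (λ l → incident? l p) k ⟩
  incident? k p            ≡⟨ incident?≡does k p ⟩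
  does (Incident? k p)     ≡⟨ dec-true (Incident? k p) k∋p ⟩
  true                     ∎)
  where open ≡-Reasoning

∈-star⁻ : ∀ {k p} → k ∈ star p → Incident k p
∈-star⁻ {k} {p} k∈star = does≡true⇒ (Incident? k p) (begin
  does (Incident? k p)     ≡⟨ incident?≡does k p ⟨
  incident? k p            ≡⟨ Vec.lookup∘tabulate (λ l → incident? l p) k ⟨
  lookup (star p) k        ≡⟨ Vec.[]=⇒lookup k∈star ⟩
  true                     ∎)
  where open ≡-Reasoning

adj-sym : ∀ {C p q} → Adj C p q → Adj C q p
adj-sym (k , k∈C , j) = k , k∈C , joins-sym {k} j

adj-lineIndex : ∀ {C p q} → p ≢ q → lineIndex p q ∈ C → Adj C p q
adj-lineIndex {p = p} {q} p≢q k∈C = lineIndex p q , k∈C , lineIndex-joins p q p≢q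

reach-trans : ∀ {C p q r} → Reach C p q → Reach C q r → Reach C p r
reach-trans p⇝q here = p⇝q
reach-trans p⇝q (step q⇝r r~s) = step (reach-trans p⇝q q⇝r) r~s

reach-sym : ∀ {C p q} → Reach C p q → Reach C q p
reach-sym here = here
reach-sym (step p⇝q q~r) = reach-trans (step here (adj-sym q~r)) (reach-sym p⇝q)

Omits⇒valence≡0 : ∀ {C p} → Omits C p → valence C p ≡ 0
Omits⇒valence≡0 {C} {p} omits = trans (cong ∣_∣ (Empty-unique nothing)) (∣⊥∣≡0 nLines)
  where
  nothing : ¬ (∃[ k ] k ∈ C ∩ star p)
  nothing (k , k∈) = let k∈C , k∈star = x∈p∩q⁻ C (star p) k∈ in omits k k∈C (∈-star⁻ k∈star)

valence≡0⇒Omits : ∀ {C p} → valence C p ≡ 0 → Omits C p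
valence≡0⇒Omits valence≡0 k k∈C k∋p = ∈⇒∣∣≢0 (x∈p∩q⁺ (k∈C , ∈-star⁺ k∋p)) valence≡0

onSquare? : ∀ p₁ p₂ p₃ p₄ k → Dec (OnSquare p₁ p₂ p₃ p₄ k)
onSquare? p₁ p₂ p₃ p₄ k = joins? k p₁ p₂ ⊎-dec joins? k p₂ p₃ ⊎-dec joins? k p₃ p₄ ⊎-dec joins? k p₄ p₁

squareLines : Point → Point → Point → Point → LineSet
squareLines p₁ p₂ p₃ p₄ = tabulate (does ∘ onSquare? p₁ p₂ p₃ p₄)

onSquare⇒∈squareLines : ∀ {p₁ p₂ p₃ p₄ k} → OnSquare p₁ p₂ p₃ p₄ k → k ∈ squareLines p₁ p₂ p₃ p₄
onSquare⇒∈squareLines {p₁} {p₂} {p₃} {p₄} {k} o = Vec.lookup⇒[]= k (squareLines p₁ p₂ p₃ p₄)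
  (trans (Vec.lookup∘tabulate (does ∘ onSquare? p₁ p₂ p₃ p₄) k) (dec-true (onSquare? p₁ p₂ p₃ p₄ k) o))

ContainsSquare⇒⊆ : ∀ {C p₁ p₂ p₃ p₄} → ContainsSquare C p₁ p₂ p₃ p₄ → squareLines p₁ p₂ p₃ p₄ ⊆ C
ContainsSquare⇒⊆ {p₁ = p₁} {p₂} {p₃} {p₄} (_ , sides) {k} k∈T = sides k
  (does≡true⇒ (onSquare? p₁ p₂ p₃ p₄ k)
    (trans (sym (Vec.lookup∘tabulate (does ∘ onSquare? p₁ p₂ p₃ p₄) k)) (Vec.[]=⇒lookup k∈T)))

square-sides : ∀ {C p₁ p₂ p₃ p₄} → ContainsSquare C p₁ p₂ p₃ p₄ →
  Adj C p₁ p₂ × Adj C p₂ p₃ × Adj C p₃ p₄ × Adj C p₄ p₁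
square-sides {p₁ = p₁} {p₂} {p₃} {p₄} ((p₁≢p₂ , _ , p₁≢p₄ , p₂≢p₃ , _ , p₃≢p₄) , sides) =
    adj-lineIndex p₁≢p₂ (sides _ (inj₁ (lineIndex-joins p₁ p₂ p₁≢p₂)))
  , adj-lineIndex p₂≢p₃ (sides _ (inj₂ (inj₁ (lineIndex-joins p₂ p₃ p₂≢p₃))))
  , adj-lineIndex p₃≢p₄ (sides _ (inj₂ (inj₂ (inj₁ (lineIndex-joins p₃ p₄ p₃≢p₄)))))
  , adj-lineIndex p₄≢p₁ (sides _ (inj₂ (inj₂ (inj₂ (lineIndex-joins p₄ p₁ p₄≢p₁)))))
  where p₄≢p₁ = p₁≢p₄ ∘ sym

square⇒cycle : ∀ {C p₁ p₂ p₃ p₄} → ContainsSquare C p₁ p₂ p₃ p₄ → Cycle C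
square⇒cycle {p₁ = p₁} {p₂} {p₃} {p₄} sq@((p₁≢p₂ , p₁≢p₃ , p₁≢p₄ , p₂≢p₃ , p₂≢p₄ , p₃≢p₄) , _) = record
  { first = p₁ ; rest = p₂ ∷ p₃ ∷ [] ; last = p₄ ; long = ℕ.s≤s ℕ.z≤n
  ; distinct = (p₁≢p₂ All.∷ p₁≢p₃ All.∷ p₁≢p₄ All.∷ All.[]) AllPairs.∷ (p₂≢p₃ All.∷ p₂≢p₄ All.∷ All.[])
               AllPairs.∷ (p₃≢p₄ All.∷ All.[]) AllPairs.∷ All.[] AllPairs.∷ AllPairs.[]
  ; path = cons p₁ p₂ _ p₁~p₂ (cons p₂ p₃ _ p₂~p₃ (cons p₃ p₄ _ p₃~p₄ (one p₄)))
  ; closes = p₄~p₁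
  }
  where
  p₁~p₂ = proj₁ (square-sides sq)
  p₂~p₃ = proj₁ (proj₂ (square-sides sq))
  p₃~p₄ = proj₁ (proj₂ (proj₂ (square-sides sq)))
  p₄~p₁ = proj₂ (proj₂ (proj₂ (square-sides sq)))

connected-cycle⇒¬IsolatedTree : ∀ {C} → Connected C → Cycle C → ¬ IsolatedTree C
connected-cycle⇒¬IsolatedTree conn cyc (v , _ , acyclic) = acyclic (cyc , conn v (Cycle.first cyc))

-- Relabelling the points

lineMap : Permutation′ 8 → LineIx → LineIx
lineMap π k = lineIndex (π ⟨$⟩ʳ proj₁ (ends k)) (π ⟨$⟩ʳ proj₂ (ends k))

lineMap-joins : ∀ π {k p q} → Joins k p q → lineMap π k ≡ lineIndex (π ⟨$⟩ʳ p) (π ⟨$⟩ʳ q)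
lineMap-joins π (inj₁ e) = cong (λ (x , y) → lineIndex (π ⟨$⟩ʳ x) (π ⟨$⟩ʳ y)) e
lineMap-joins π {p = p} {q} (inj₂ e) =
  trans (cong (λ (x , y) → lineIndex (π ⟨$⟩ʳ x) (π ⟨$⟩ʳ y)) e) (lineIndex-comm (π ⟨$⟩ʳ q) (π ⟨$⟩ʳ p))

joins-lineMap : ∀ π {k p q} → Joins k p q → Joins (lineMap π k) (π ⟨$⟩ʳ p) (π ⟨$⟩ʳ q)
joins-lineMap π {k} {p} {q} j = subst (λ l → Joins l (π ⟨$⟩ʳ p) (π ⟨$⟩ʳ q)) (sym (lineMap-joins π {k} j))
  (lineIndex-joins (π ⟨$⟩ʳ p) (π ⟨$⟩ʳ q) (joins⇒≢ {k} j ∘ permute-injective π))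

lineMap-inverse : ∀ π k → lineMap (flip π) (lineMap π k) ≡ k
lineMap-inverse π k = begin
  lineMap (flip π) (lineMap π k)
    ≡⟨ lineMap-joins (flip π) {lineMap π k} (joins-lineMap π {k} (inj₁ refl)) ⟩
  lineIndex (π ⟨$⟩ˡ (π ⟨$⟩ʳ proj₁ (ends k))) (π ⟨$⟩ˡ (π ⟨$⟩ʳ proj₂ (ends k)))
    ≡⟨ cong₂ lineIndex (inverseˡ π) (inverseˡ π) ⟩
  lineIndex (proj₁ (ends k)) (proj₂ (ends k))
    ≡⟨ lineIndex-ends k ⟩
  k
    ∎
  where open ≡-Reasoning

linePermutation : Permutation′ 8 → Permutation′ nLines
linePermutation π = permutation (lineMap π) (lineMap (flip π)) (lineMap-inverse (flip π)) (lineMap-inverse π)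

infixr 8 _·_

_·_ : Permutation′ 8 → LineSet → LineSet
π · C = permuteSubset (linePermutation π) C

incident-lineMap : ∀ π {k p} → Incident k p → Incident (lineMap π k) (π ⟨$⟩ʳ p)
incident-lineMap π {k} k∋p = joins⇒incident {lineMap π k} (joins-lineMap π {k} (proj₂ (incident⇒joins {k} k∋p)))

incident-lineMap⇔ : ∀ π k p → Incident k (π ⟨$⟩ʳ p) ⇔ Incident (lineMap (flip π) k) p
incident-lineMap⇔ π k p = mk⇔
  (λ k∋πp → subst (Incident (lineMap (flip π) k)) (inverseˡ π) (incident-lineMap (flip π) {k} k∋πp))
  (λ k∋p → subst (λ l → Incident l (π ⟨$⟩ʳ p)) (lineMap-inverse (flip π) k)
                 (incident-lineMap π {lineMap (flip π) k} k∋p))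

adj-· : ∀ π {C p q} → Adj C p q → Adj (π · C) (π ⟨$⟩ʳ p) (π ⟨$⟩ʳ q)
adj-· π (k , k∈C , j) = lineMap π k , ∈-permuteSubset (linePermutation π) k∈C , joins-lineMap π {k} j

reach-· : ∀ π {C p q} → Reach C p q → Reach (π · C) (π ⟨$⟩ʳ p) (π ⟨$⟩ʳ q)
reach-· π here = here
reach-· π (step p⇝q q~r) = step (reach-· π p⇝q) (adj-· π q~r)

Connected-· : ∀ π {C} → Connected C → Connected (π · C)
Connected-· π conn p q = subst₂ (Reach _) (inverseʳ π) (inverseʳ π) (reach-· π (conn (π ⟨$⟩ˡ p) (π ⟨$⟩ˡ q)))

Omits-· : ∀ π {C p} → Omits (π · C) (π ⟨$⟩ʳ p) → Omits C p
Omits-· π om k k∈C k∋p = om (lineMap π k) (∈-permuteSubset (linePermutation π) k∈C) (incident-lineMap π {k} k∋p)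

star-· : ∀ π p → star (π ⟨$⟩ʳ p) ≡ permuteSubset (linePermutation π) (star p)
star-· π p = lookup-extensional λ k → begin
  lookup (star (π ⟨$⟩ʳ p)) k
    ≡⟨ Vec.lookup∘tabulate (λ l → incident? l (π ⟨$⟩ʳ p)) k ⟩
  incident? k (π ⟨$⟩ʳ p)
    ≡⟨ incident?≡does k (π ⟨$⟩ʳ p) ⟩
  does (Incident? k (π ⟨$⟩ʳ p))
    ≡⟨ does-⇔ (incident-lineMap⇔ π k p) (Incident? k (π ⟨$⟩ʳ p)) (Incident? (lineMap (flip π) k) p) ⟩
  does (Incident? (lineMap (flip π) k) p)
    ≡⟨ incident?≡does (lineMap (flip π) k) p ⟨
  incident? (lineMap (flip π) k) p
    ≡⟨ Vec.lookup∘tabulate (λ l → incident? l p) (lineMap (flip π) k) ⟨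
  lookup (star p) (lineMap (flip π) k)
    ≡⟨ lookup-permuteSubset (linePermutation π) (star p) k ⟨
  lookup (permuteSubset (linePermutation π) (star p)) k
    ∎
  where open ≡-Reasoning

valence-· : ∀ π C p → valence (π · C) (π ⟨$⟩ʳ p) ≡ valence C p
valence-· π C p = begin
  ∣ π · C ∩ star (π ⟨$⟩ʳ p) ∣   ≡⟨ cong (λ s → ∣ π · C ∩ s ∣) (star-· π p) ⟩
  ∣ π · C ∩ permuteSubset (linePermutation π) (star p) ∣
                                 ≡⟨ cong ∣_∣ (permuteSubset-∩ (linePermutation π) C (star p)) ⟨
  ∣ π · (C ∩ star p) ∣           ≡⟨ ∣permuteSubset∣ (linePermutation π) (C ∩ star p) ⟩
  ∣ C ∩ star p ∣                 ∎
  where open ≡-Reasoning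

OnSquare-resp : ∀ {p₁ p₂ p₃ p₄ q₁ q₂ q₃ q₄ k l} → p₁ ≡ q₁ → p₂ ≡ q₂ → p₃ ≡ q₃ → p₄ ≡ q₄ → k ≡ l →
  OnSquare p₁ p₂ p₃ p₄ k → OnSquare q₁ q₂ q₃ q₄ l
OnSquare-resp refl refl refl refl refl o = o

onSquare-lineMap : ∀ π {p₁ p₂ p₃ p₄} k → OnSquare p₁ p₂ p₃ p₄ k →
  OnSquare (π ⟨$⟩ʳ p₁) (π ⟨$⟩ʳ p₂) (π ⟨$⟩ʳ p₃) (π ⟨$⟩ʳ p₄) (lineMap π k)
onSquare-lineMap π k =
  Sum.map (joins-lineMap π {k}) (Sum.map (joins-lineMap π {k}) (Sum.map (joins-lineMap π {k}) (joins-lineMap π {k})))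

onSquare-lineMap⁻¹ : ∀ π {p₁ p₂ p₃ p₄} k → OnSquare (π ⟨$⟩ʳ p₁) (π ⟨$⟩ʳ p₂) (π ⟨$⟩ʳ p₃) (π ⟨$⟩ʳ p₄) k →
  OnSquare p₁ p₂ p₃ p₄ (lineMap (flip π) k)
onSquare-lineMap⁻¹ π k o =
  OnSquare-resp {k = lineMap (flip π) k} (inverseˡ π) (inverseˡ π) (inverseˡ π) (inverseˡ π) refl
    (onSquare-lineMap (flip π) k o)

ContainsSquare-· : ∀ π {C a b c d} → ContainsSquare C a b c d →
  ContainsSquare (π · C) (π ⟨$⟩ʳ a) (π ⟨$⟩ʳ b) (π ⟨$⟩ʳ c) (π ⟨$⟩ʳ d)
ContainsSquare-· π {C} ((a≢b , a≢c , a≢d , b≢c , b≢d , c≢d) , sides) =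
  (respect a≢b , respect a≢c , respect a≢d , respect b≢c , respect b≢d , respect c≢d) ,
  λ k o → subst (_∈ π · C) (lineMap-inverse (flip π) k)
                (∈-permuteSubset (linePermutation π) (sides (lineMap (flip π) k) (onSquare-lineMap⁻¹ π k o)))
  where
  respect : ∀ {p q} → p ≢ q → π ⟨$⟩ʳ p ≢ π ⟨$⟩ʳ q
  respect p≢q = p≢q ∘ permute-injective π

UniqueSquare-· : ∀ π {C a b c d} → UniqueSquare C a b c d →
  UniqueSquare (π · C) (π ⟨$⟩ʳ a) (π ⟨$⟩ʳ b) (π ⟨$⟩ʳ c) (π ⟨$⟩ʳ d)
UniqueSquare-· π {C} {a} {b} {c} {d} (sq , unique) = ContainsSquare-· π sq , λ p₁ p₂ p₃ p₄ sq′ k →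
  let k′ = lineMap (flip π) k in
    (λ o → subst (OnSquare (π ⟨$⟩ʳ a) (π ⟨$⟩ʳ b) (π ⟨$⟩ʳ c) (π ⟨$⟩ʳ d)) (lineMap-inverse (flip π) k)
             (onSquare-lineMap π k′ (proj₁ (same sq′ k′) (onSquare-lineMap (flip π) k o))))
  , (λ o → OnSquare-resp (inverseʳ π) (inverseʳ π) (inverseʳ π) (inverseʳ π) (lineMap-inverse (flip π) k)
             (onSquare-lineMap π k′ (proj₂ (same sq′ k′) (onSquare-lineMap⁻¹ π k o))))
  where
  same : ∀ {p₁ p₂ p₃ p₄} → ContainsSquare (π · C) p₁ p₂ p₃ p₄ → ∀ k →
    (OnSquare (π ⟨$⟩ˡ p₁) (π ⟨$⟩ˡ p₂) (π ⟨$⟩ˡ p₃) (π ⟨$⟩ˡ p₄) k → OnSquare a b c d k) ×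
    (OnSquare a b c d k → OnSquare (π ⟨$⟩ˡ p₁) (π ⟨$⟩ˡ p₂) (π ⟨$⟩ˡ p₃) (π ⟨$⟩ˡ p₄) k)
  same sq′ = unique _ _ _ _
    (subst (λ D → ContainsSquare D _ _ _ _) (permuteSubset-inverse (linePermutation π) C)
      (ContainsSquare-· (flip π) sq′))

ExactlyThreeHigh-· : ∀ π {C a b c d} → ExactlyThreeHigh C a b c d →
  ExactlyThreeHigh (π · C) (π ⟨$⟩ʳ a) (π ⟨$⟩ʳ b) (π ⟨$⟩ʳ c) (π ⟨$⟩ʳ d)
ExactlyThreeHigh-· π {C} {a} {b} {c} {d} =
  trans (length-filter-map (λ p → 2 ℕ.<? valence (π · C) p) (λ p → 2 ℕ.<? valence C p) (π ⟨$⟩ʳ_) high⇔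
    (a ∷ b ∷ c ∷ d ∷ []))
  where
  high⇔ : ∀ p → 2 ℕ.< valence (π · C) (π ⟨$⟩ʳ p) ⇔ 2 ℕ.< valence C p
  high⇔ p = mk⇔ (subst (2 ℕ.<_) (valence-· π C p)) (subst (2 ℕ.<_) (sym (valence-· π C p)))

Counted-· : ∀ π {a b c d C} → Counted a b c d C → Counted (π ⟨$⟩ʳ a) (π ⟨$⟩ʳ b) (π ⟨$⟩ʳ c) (π ⟨$⟩ʳ d) (π · C)
Counted-· π {C = C} (size , conn , (covers , _) , unique , three) =
    trans (∣permuteSubset∣ (linePermutation π) C) size
  , conn′
  , (covers′ , connected-cycle⇒¬IsolatedTree conn′ (square⇒cycle (proj₁ unique′)))
  , unique′
  , ExactlyThreeHigh-· π {C} three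
  where
  conn′ = Connected-· π conn
  unique′ = UniqueSquare-· π unique
  covers′ : ∀ p → ¬ Omits (π · C) p
  covers′ p om = covers (π ⟨$⟩ˡ p) (Omits-· π (subst (Omits (π · C)) (sym (inverseʳ π)) om))

Counted-resp : ∀ {a b c d a′ b′ c′ d′ C} → a ≡ a′ → b ≡ b′ → c ≡ c′ → d ≡ d′ →
  Counted a b c d C → Counted a′ b′ c′ d′ C
Counted-resp refl refl refl refl counted = counted

squarePermutation : ∀ {a b c d} → Distinct4 a b c d →
  Σ (Permutation′ 8) λ π → π ⟨$⟩ʳ # 0 ≡ a × π ⟨$⟩ʳ # 1 ≡ b × π ⟨$⟩ʳ # 2 ≡ c × π ⟨$⟩ʳ # 3 ≡ d
squarePermutation {a} {b} {c} {d} (a≢b , a≢c , a≢d , b≢c , b≢d , c≢d) =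
  π₄ , π₄0≡a , π₄1≡b , π₄2≡c , redirect-at π₃ (# 3) d
  where
  π₁ π₂ π₃ π₄ : Permutation′ 8
  π₁ = redirect Permutation.id (# 0) a
  π₂ = redirect π₁ (# 1) b
  π₃ = redirect π₂ (# 2) c
  π₄ = redirect π₃ (# 3) d
  π₂0≡a : π₂ ⟨$⟩ʳ # 0 ≡ a
  π₂0≡a = redirect-keeps π₁ {# 0} {# 1} (λ ()) (redirect-at Permutation.id (# 0) a) a≢b
  π₃0≡a : π₃ ⟨$⟩ʳ # 0 ≡ a
  π₃0≡a = redirect-keeps π₂ {# 0} {# 2} (λ ()) π₂0≡a a≢c
  π₃1≡b : π₃ ⟨$⟩ʳ # 1 ≡ b
  π₃1≡b = redirect-keeps π₂ {# 1} {# 2} (λ ()) (redirect-at π₁ (# 1) b) b≢c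
  π₄0≡a : π₄ ⟨$⟩ʳ # 0 ≡ a
  π₄0≡a = redirect-keeps π₃ {# 0} {# 3} (λ ()) π₃0≡a a≢d
  π₄1≡b : π₄ ⟨$⟩ʳ # 1 ≡ b
  π₄1≡b = redirect-keeps π₃ {# 1} {# 3} (λ ()) π₃1≡b b≢d
  π₄2≡c : π₄ ⟨$⟩ʳ # 2 ≡ c
  π₄2≡c = redirect-keeps π₃ {# 2} {# 3} (λ ()) (redirect-at π₂ (# 2) c) c≢d

HasCount-transport : ∀ {Q Q′ : LineSet → Set} {n} (f g : LineSet → LineSet) →
  (∀ C → g (f C) ≡ C) → (∀ C → f (g C) ≡ C) →
  (∀ {C} → Q C → Q′ (f C)) → (∀ {C} → Q′ C → Q (g C)) → HasCount Q n → HasCount Q′ n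
HasCount-transport {Q} {Q′} f g g∘f f∘g Q⇒Q′ Q′⇒Q (L , unique , spec , len) =
  map f L , Unique.map⁺ f-injective unique , (λ C → sound C , complete C) , trans (List.length-map f L) len
  where
  f-injective : ∀ {C D} → f C ≡ f D → C ≡ D
  f-injective {C} {D} fC≡fD = trans (sym (g∘f C)) (trans (cong g fC≡fD) (g∘f D))
  sound : ∀ C → C ∈ₗ map f L → Q′ C
  sound C C∈fL with Membership.∈-map⁻ f C∈fL
  ... | D , D∈L , refl = Q⇒Q′ (proj₁ (spec D) D∈L)
  complete : ∀ C → Q′ C → C ∈ₗ map f L
  complete C q′ = subst (_∈ₗ map f L) (f∘g C) (Membership.∈-map⁺ f (proj₂ (spec (g C)) (Q′⇒Q q′)))

-- Enumerating supersets with their valences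

module Enumeration {E S : Set} (step : E → S → S) where

  accumulate : ∀ {m} → Subset m → Vec E m → S → S
  accumulate [] [] s = s
  accumulate (b ∷ C) (e ∷ es) s = accumulate C es (if b then step e s else s)

  module _ (accept : S → Bool) where

    -- The state is threaded through the branching, so it is shared by all extensions of a common prefix.
    supersets : ∀ {m} → Subset m → Vec E m → ℕ → S → List (Subset m)
    supersets [] [] zero s = if accept s then [] ∷ [] else []
    supersets [] [] (suc k) s = []
    supersets (inside ∷ F) (e ∷ es) zero s = []
    supersets (inside ∷ F) (e ∷ es) (suc k) s = map (inside ∷_) (supersets F es k (step e s))
    supersets (outside ∷ F) (e ∷ es) zero s = map (outside ∷_) (supersets F es zero s)
    supersets (outside ∷ F) (e ∷ es) (suc k) s =
      map (outside ∷_) (supersets F es (suc k) s) ++ map (inside ∷_) (supersets F es k (step e s))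

    private
      ∈-map-∷⁻ : ∀ {m} {b} {C : Subset (suc m)} {Cs : List (Subset m)} → C ∈ₗ map (b ∷_) Cs →
        ∃[ D ] (D ∈ₗ Cs × C ≡ b ∷ D)
      ∈-map-∷⁻ {b = b} = Membership.∈-map⁻ (b ∷_)

      ∷-injectiveʳ : ∀ {m} {b} {C D : Subset m} → b ∷ C ≡ b ∷ D → C ≡ D
      ∷-injectiveʳ refl = refl

    supersets-sound : ∀ {m} (F : Subset m) es k s C → C ∈ₗ supersets F es k s →
      F ⊆ C × ∣ C ∣ ≡ k × accept (accumulate C es s) ≡ true
    supersets-sound [] [] zero s [] C∈ with accept s
    ... | true = (λ ()) , refl , refl
    supersets-sound (inside ∷ F) (e ∷ es) (suc k) s _ C∈ with ∈-map-∷⁻ C∈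
    ... | D , D∈ , refl with supersets-sound F es k (step e s) D D∈
    ...   | F⊆D , ∣D∣≡k , accepted = s⊆s F⊆D , cong suc ∣D∣≡k , accepted
    supersets-sound (outside ∷ F) (e ∷ es) zero s _ C∈ with ∈-map-∷⁻ C∈
    ... | D , D∈ , refl with supersets-sound F es zero s D D∈
    ...   | F⊆D , ∣D∣≡k , accepted = s⊆s F⊆D , ∣D∣≡k , accepted
    supersets-sound (outside ∷ F) (e ∷ es) (suc k) s C C∈
      with Membership.∈-++⁻ (map (outside ∷_) (supersets F es (suc k) s)) C∈
    ... | inj₁ C∈₁ with ∈-map-∷⁻ C∈₁
    ...   | D , D∈ , refl with supersets-sound F es (suc k) s D D∈
    ...     | F⊆D , ∣D∣≡k , accepted = s⊆s F⊆D , ∣D∣≡k , accepted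
    supersets-sound (outside ∷ F) (e ∷ es) (suc k) s C C∈ | inj₂ C∈₂ with ∈-map-∷⁻ C∈₂
    ...   | D , D∈ , refl with supersets-sound F es k (step e s) D D∈
    ...     | F⊆D , ∣D∣≡k , accepted = out⊆ F⊆D , cong suc ∣D∣≡k , accepted

    supersets-complete : ∀ {m} (F : Subset m) es s C → F ⊆ C → accept (accumulate C es s) ≡ true →
      C ∈ₗ supersets F es ∣ C ∣ s
    supersets-complete [] [] s [] _ accepted rewrite accepted = here refl
    supersets-complete (inside ∷ F) (e ∷ es) s (outside ∷ C) F⊆C _ with F⊆C Vec.here
    ... | ()
    supersets-complete (inside ∷ F) (e ∷ es) s (inside ∷ C) F⊆C accepted =
      Membership.∈-map⁺ (inside ∷_) (supersets-complete F es (step e s) C (drop-∷-⊆ F⊆C) accepted)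
    supersets-complete (outside ∷ F) (e ∷ es) s (outside ∷ C) F⊆C accepted
      with ∣ C ∣ | supersets-complete F es s C (drop-∷-⊆ F⊆C) accepted
    ... | zero  | C∈ = Membership.∈-map⁺ (outside ∷_) C∈
    ... | suc _ | C∈ = Membership.∈-++⁺ˡ (Membership.∈-map⁺ (outside ∷_) C∈)
    supersets-complete (outside ∷ F) (e ∷ es) s (inside ∷ C) F⊆C accepted =
      Membership.∈-++⁺ʳ (map (outside ∷_) (supersets F es (suc ∣ C ∣) s))
        (Membership.∈-map⁺ (inside ∷_) (supersets-complete F es (step e s) C (drop-∷-⊆ F⊆C) accepted))

    supersets-unique : ∀ {m} (F : Subset m) es k s → Unique (supersets F es k s)
    supersets-unique [] [] zero s with accept s
    ... | true = All.[] AllPairs.∷ AllPairs.[]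
    ... | false = AllPairs.[]
    supersets-unique [] [] (suc k) s = AllPairs.[]
    supersets-unique (inside ∷ F) (e ∷ es) zero s = AllPairs.[]
    supersets-unique (inside ∷ F) (e ∷ es) (suc k) s = Unique.map⁺ ∷-injectiveʳ (supersets-unique F es k (step e s))
    supersets-unique (outside ∷ F) (e ∷ es) zero s = Unique.map⁺ ∷-injectiveʳ (supersets-unique F es zero s)
    supersets-unique (outside ∷ F) (e ∷ es) (suc k) s =
      Unique.++⁺ (Unique.map⁺ ∷-injectiveʳ (supersets-unique F es (suc k) s))
                 (Unique.map⁺ ∷-injectiveʳ (supersets-unique F es k (step e s)))
                 outside≢inside
      where
      outside≢inside : ∀ {C} →
        ¬ (C ∈ₗ map (outside ∷_) (supersets F es (suc k) s) × C ∈ₗ map (inside ∷_) (supersets F es k (step e s)))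
      outside≢inside (C∈₁ , C∈₂) with ∈-map-∷⁻ C∈₁ | ∈-map-∷⁻ C∈₂
      ... | _ , _ , refl | _ , _ , ()

Valences : Set
Valences = Vec ℕ 8

addLine : Point × Point → Valences → Valences
addLine (p , q) v = updateAt (updateAt v p suc) q suc

incidentᵇ : Point × Point → Point → Bool
incidentᵇ (p , q) r = ⌊ p ≟ r ⌋ ∨ ⌊ q ≟ r ⌋

lookup-addLine : ∀ {p q} → p ≢ q → ∀ v r → lookup (addLine (p , q) v) r ≡ lookup v r + indicator (incidentᵇ (p , q) r)
lookup-addLine {p} {q} p≢q v r with p ≟ r | q ≟ r
... | yes refl | yes refl = contradiction refl p≢q
... | yes refl | no q≢p = begin
  lookup (updateAt (updateAt v p suc) q suc) p ≡⟨ Vec.lookup∘updateAt′ p q (q≢p ∘ sym) (updateAt v p suc) ⟩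
  lookup (updateAt v p suc) p                   ≡⟨ Vec.lookup∘updateAt p v ⟩
  suc (lookup v p)                              ≡⟨ ℕ.+-comm 1 (lookup v p) ⟩
  lookup v p + 1                                ∎
  where open ≡-Reasoning
... | no p≢r | yes refl = begin
  lookup (updateAt (updateAt v p suc) q suc) q ≡⟨ Vec.lookup∘updateAt q (updateAt v p suc) ⟩
  suc (lookup (updateAt v p suc) q)             ≡⟨ cong suc (Vec.lookup∘updateAt′ q p (p≢q ∘ sym) v) ⟩
  suc (lookup v q)                              ≡⟨ ℕ.+-comm 1 (lookup v q) ⟩
  lookup v q + 1                                ∎
  where open ≡-Reasoning
... | no p≢r | no q≢r = begin
  lookup (updateAt (updateAt v p suc) q suc) r ≡⟨ Vec.lookup∘updateAt′ r q (q≢r ∘ sym) (updateAt v p suc) ⟩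
  lookup (updateAt v p suc) r                   ≡⟨ Vec.lookup∘updateAt′ r p (p≢r ∘ sym) v ⟩
  lookup v r                                    ≡⟨ ℕ.+-identityʳ (lookup v r) ⟨
  lookup v r + 0                                ∎
  where open ≡-Reasoning

open Enumeration addLine

lookup-accumulate : ∀ {m} (C : Subset m) (es : Vec (Point × Point) m) →
  (∀ i → proj₁ (lookup es i) ≢ proj₂ (lookup es i)) →
  ∀ v r → lookup (accumulate C es v) r ≡ lookup v r + ∣ C ∩ Vec.map (λ e → incidentᵇ e r) es ∣
lookup-accumulate [] [] _ v r = sym (ℕ.+-identityʳ (lookup v r))
lookup-accumulate (outside ∷ C) (e ∷ es) distinct v r = lookup-accumulate C es (distinct ∘ suc) v r
lookup-accumulate (inside ∷ C) (e ∷ es) distinct v r = begin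
  lookup (accumulate C es (addLine e v)) r
    ≡⟨ lookup-accumulate C es (distinct ∘ suc) (addLine e v) r ⟩
  lookup (addLine e v) r + ∣ C ∩ incidences ∣
    ≡⟨ cong (_+ ∣ C ∩ incidences ∣) (lookup-addLine (distinct zero) v r) ⟩
  lookup v r + indicator (incidentᵇ e r) + ∣ C ∩ incidences ∣
    ≡⟨ ℕ.+-assoc (lookup v r) _ _ ⟩
  lookup v r + (indicator (incidentᵇ e r) + ∣ C ∩ incidences ∣)
    ≡⟨ cong (lookup v r +_) (∣inside∷∣ (incidentᵇ e r)) ⟩
  lookup v r + ∣ (inside ∷ C) ∩ (incidentᵇ e r ∷ incidences) ∣
    ∎
  where
  open ≡-Reasoning
  incidences = Vec.map (λ e → incidentᵇ e r) es
  ∣inside∷∣ : ∀ b → indicator b + ∣ C ∩ incidences ∣ ≡ ∣ (inside ∷ C) ∩ (b ∷ incidences) ∣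
  ∣inside∷∣ true = refl
  ∣inside∷∣ false = refl

star-endpointTable : ∀ r → star r ≡ Vec.map (λ e → incidentᵇ e r) endpointTable
star-endpointTable r = lookup-extensional λ k → begin
  lookup (star r) k
    ≡⟨ Vec.lookup∘tabulate (λ l → incident? l r) k ⟩
  incidentᵇ (ends k) r
    ≡⟨ cong (λ e → incidentᵇ e r) (endpointTable-ends k) ⟨
  incidentᵇ (lookup endpointTable k) r
    ≡⟨ Vec.lookup-map k (λ e → incidentᵇ e r) endpointTable ⟨
  lookup (Vec.map (λ e → incidentᵇ e r) endpointTable) k
    ∎
  where open ≡-Reasoning

valences : LineSet → Valences
valences C = accumulate C endpointTable (replicate 8 0)

lookup-valences : ∀ C r → lookup (valences C) r ≡ valence C r
lookup-valences C r = begin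
  lookup (valences C) r
    ≡⟨ lookup-accumulate C endpointTable distinct _ r ⟩
  lookup (replicate 8 0) r + ∣ C ∩ Vec.map (λ e → incidentᵇ e r) endpointTable ∣
    ≡⟨ cong₂ (λ n s → n + ∣ C ∩ s ∣) (Vec.lookup-replicate r 0) (sym (star-endpointTable r)) ⟩
  ∣ C ∩ star r ∣
    ∎
  where
  open ≡-Reasoning
  distinct : ∀ k → proj₁ (lookup endpointTable k) ≢ proj₂ (lookup endpointTable k)
  distinct k rewrite endpointTable-ends k = ends-distinct k

-- Connectivity

edgesOf : ∀ {A : Set} {m} → Subset m → Vec A m → List A
edgesOf [] [] = []
edgesOf (inside ∷ C) (e ∷ es) = e ∷ edgesOf C es
edgesOf (outside ∷ C) (e ∷ es) = edgesOf C es

∈-edgesOf⁺ : ∀ {A : Set} {m} {C : Subset m} {k} (es : Vec A m) → k ∈ C → lookup es k ∈ₗ edgesOf C es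
∈-edgesOf⁺ {C = inside ∷ _} (e ∷ es) Vec.here = here refl
∈-edgesOf⁺ {C = inside ∷ _} (e ∷ es) (Vec.there k∈C) = there (∈-edgesOf⁺ es k∈C)
∈-edgesOf⁺ {C = outside ∷ _} (e ∷ es) (Vec.there k∈C) = ∈-edgesOf⁺ es k∈C

∈-edgesOf⁻ : ∀ {A : Set} {m} (C : Subset m) (es : Vec A m) {x} → x ∈ₗ edgesOf C es → ∃[ k ] (k ∈ C × lookup es k ≡ x)
∈-edgesOf⁻ [] [] ()
∈-edgesOf⁻ (inside ∷ C) (e ∷ es) (here refl) = zero , Vec.here , refl
∈-edgesOf⁻ (inside ∷ C) (e ∷ es) (there x∈) = Product.map suc (Product.map₁ Vec.there) (∈-edgesOf⁻ C es x∈)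
∈-edgesOf⁻ (outside ∷ C) (e ∷ es) x∈ = Product.map suc (Product.map₁ Vec.there) (∈-edgesOf⁻ C es x∈)

edgeList : LineSet → List (Point × Point)
edgeList C = edgesOf C endpointTable

∈-edgeList⇒adj : ∀ {C p q} → (p , q) ∈ₗ edgeList C → Adj C p q
∈-edgeList⇒adj {C} pq∈ with ∈-edgesOf⁻ C endpointTable pq∈
... | k , k∈C , k↦pq = k , k∈C , inj₁ (trans (sym (endpointTable-ends k)) k↦pq)

adj⇒∈-edgeList : ∀ {C p q} → Adj C p q → (p , q) ∈ₗ edgeList C ⊎ (q , p) ∈ₗ edgeList C
adj⇒∈-edgeList {C} (k , k∈C , j) = Sum.map (λ e → listed e) (λ e → listed e) j
  where
  listed : ∀ {x} → ends k ≡ x → x ∈ₗ edgeList C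
  listed e = subst (_∈ₗ edgeList C) (trans (endpointTable-ends k) e) (∈-edgesOf⁺ endpointTable k∈C)

spread : List (Point × Point) → Subset 8 → Subset 8
spread [] S = S
spread ((p , q) ∷ ls) S = spread ls (if lookup S p ∨ lookup S q then (S [ p ]≔ inside) [ q ]≔ inside else S)

-- That eight passes reach the whole component is not proved: ComponentCertified checks what is needed.
component : LineSet → Subset 8
component C = iterate (spread (edgeList C)) ⁅ # 0 ⁆ 8

ReachableSet : LineSet → Subset 8 → Set
ReachableSet C S = ∀ r → lookup S r ≡ inside → Reach C (# 0) r

join-reachable : ∀ {C S p q} → Adj C p q → ReachableSet C S → lookup S p ∨ lookup S q ≡ true →
  ReachableSet C ((S [ p ]≔ inside) [ q ]≔ inside)
join-reachable {C} {S} {p} {q} p~q reachable p∨q∈S r r∈S′ with r ≟ q | r ≟ p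
... | yes refl | _ = Sum.[ (λ p∈S → step (reachable p p∈S) p~q) , (λ q∈S → reachable q q∈S) ] (∨≡true⇒ p∨q∈S)
... | no _ | yes refl =
  Sum.[ (λ p∈S → reachable p p∈S) , (λ q∈S → step (reachable q q∈S) (adj-sym p~q)) ] (∨≡true⇒ p∨q∈S)
... | no r≢q | no r≢p = reachable r (trans (sym (trans (Vec.lookup∘update′ r≢q (S [ p ]≔ inside) inside)
                                                      (Vec.lookup∘update′ r≢p S inside))) r∈S′)

spread-reachable : ∀ {C} ls → (∀ {p q} → (p , q) ∈ₗ ls → Adj C p q) →
  ∀ {S} → ReachableSet C S → ReachableSet C (spread ls S)
spread-reachable [] _ reachable = reachable
spread-reachable ((p , q) ∷ ls) adjacent {S} reachable with lookup S p ∨ lookup S q in p∨q∈S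
... | true = spread-reachable ls (adjacent ∘ there) (join-reachable {S = S} (adjacent (here refl)) reachable p∨q∈S)
... | false = spread-reachable ls (adjacent ∘ there) reachable

component-reachable : ∀ C → ReachableSet C (component C)
component-reachable C = grow 8 ⁅0⁆-reachable
  where
  grow : ∀ n {S} → ReachableSet C S → ReachableSet C (iterate (spread (edgeList C)) S n)
  grow zero reachable = reachable
  grow (suc n) reachable = grow n (spread-reachable (edgeList C) ∈-edgeList⇒adj reachable)
  ⁅0⁆-reachable : ReachableSet C ⁅ # 0 ⁆
  ⁅0⁆-reachable zero _ = here
  ⁅0⁆-reachable (suc r) r∈⁅0⁆ = contradiction (trans (sym (Vec.lookup-replicate r outside)) r∈⁅0⁆) λ ()

component≡⊤⇒connected : ∀ C → component C ≡ ⊤ → Connected C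
component≡⊤⇒connected C component≡⊤ p q = reach-trans (reach-sym (from0 p)) (from0 q)
  where
  from0 : ∀ r → Reach C (# 0) r
  from0 r = component-reachable C r (trans (cong (λ S → lookup S r) component≡⊤) (Vec.lookup-replicate r inside))

Balanced : Subset 8 → Point × Point → Set
Balanced S (p , q) = lookup S p ≡ lookup S q

Closed : List (Point × Point) → Subset 8 → Set
Closed ls S = All (Balanced S) ls

closed-reach : ∀ {C S p q} → Closed (edgeList C) S → Reach C p q → lookup S p ≡ lookup S q
closed-reach closed here = refl
closed-reach {C} {S} closed (step {q} {r} p⇝q q~r) =
  trans (closed-reach {C} {S} closed p⇝q) (Sum.[ balanced , sym ∘ balanced ] (adj⇒∈-edgeList {C} q~r))
  where
  balanced : ∀ {x y} → (x , y) ∈ₗ edgeList C → lookup S x ≡ lookup S y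
  balanced = All.lookup closed

connected⇒component≡⊤ : ∀ {C} → Connected C → Closed (edgeList C) (component C) → # 0 ∈ component C → component C ≡ ⊤
connected⇒component≡⊤ {C} conn closed 0∈ = lookup-extensional λ r → begin
  lookup (component C) r    ≡⟨ closed-reach {C} {component C} closed (conn r (# 0)) ⟩
  lookup (component C) (# 0) ≡⟨ Vec.[]=⇒lookup 0∈ ⟩
  inside                    ≡⟨ Vec.lookup-replicate r inside ⟨
  lookup ⊤ r                ∎
  where open ≡-Reasoning

-- Four-cycles

module PointLists = DecMembership (_≟_ {8})
module LineLists = DecListSubset (_≟_ {nLines})

neighboursOf : List (Point × Point) → Point → List Point
neighboursOf [] p = []
neighboursOf ((x , y) ∷ ls) p =
  if does (x ≟ p) then y ∷ neighboursOf ls p else (if does (y ≟ p) then x ∷ neighboursOf ls p else neighboursOf ls p)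

∈-neighboursOf-there : ∀ {p z} x y ls → z ∈ₗ neighboursOf ls p → z ∈ₗ neighboursOf ((x , y) ∷ ls) p
∈-neighboursOf-there {p} x y ls z∈ with does (x ≟ p) | does (y ≟ p)
... | true  | _     = there z∈
... | false | true  = there z∈
... | false | false = z∈

∈-neighboursOf⁺ˡ : ∀ {x y} ls → (x , y) ∈ₗ ls → y ∈ₗ neighboursOf ls x
∈-neighboursOf⁺ˡ {x} (_ ∷ ls) (here refl) rewrite dec-true (x ≟ x) refl = here refl
∈-neighboursOf⁺ˡ ((u , v) ∷ ls) (there xy∈) = ∈-neighboursOf-there u v ls (∈-neighboursOf⁺ˡ ls xy∈)

∈-neighboursOf⁺ʳ : ∀ {x y} ls → (x , y) ∈ₗ ls → x ∈ₗ neighboursOf ls y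
∈-neighboursOf⁺ʳ {x} {y} (_ ∷ ls) (here refl) with x ≟ y
... | yes refl = here refl
... | no _ rewrite dec-true (y ≟ y) refl = here refl
∈-neighboursOf⁺ʳ ((u , v) ∷ ls) (there xy∈) = ∈-neighboursOf-there u v ls (∈-neighboursOf⁺ʳ ls xy∈)

adj⇒∈-neighbours : ∀ {C p q} → Adj C p q → q ∈ₗ neighboursOf (edgeList C) p
adj⇒∈-neighbours {C} p~q =
  Sum.[ ∈-neighboursOf⁺ˡ (edgeList C) , ∈-neighboursOf⁺ʳ (edgeList C) ] (adj⇒∈-edgeList {C} p~q)

sides : Point → Point → Point → Point → List LineIx
sides p₁ p₂ p₃ p₄ = lineIndex p₁ p₂ ∷ lineIndex p₂ p₃ ∷ lineIndex p₃ p₄ ∷ lineIndex p₄ p₁ ∷ []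

onSquare⇒∈sides : ∀ {p₁ p₂ p₃ p₄} k → OnSquare p₁ p₂ p₃ p₄ k → k ∈ₗ sides p₁ p₂ p₃ p₄
onSquare⇒∈sides k (inj₁ j) = here (joins⇒≡lineIndex {k} j)
onSquare⇒∈sides k (inj₂ (inj₁ j)) = there (here (joins⇒≡lineIndex {k} j))
onSquare⇒∈sides k (inj₂ (inj₂ (inj₁ j))) = there (there (here (joins⇒≡lineIndex {k} j)))
onSquare⇒∈sides k (inj₂ (inj₂ (inj₂ j))) = there (there (there (here (joins⇒≡lineIndex {k} j))))

∈sides⇒onSquare : ∀ {p₁ p₂ p₃ p₄ k} → Distinct4 p₁ p₂ p₃ p₄ → k ∈ₗ sides p₁ p₂ p₃ p₄ → OnSquare p₁ p₂ p₃ p₄ k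
∈sides⇒onSquare {p₁} {p₂} (p₁≢p₂ , _) (here refl) = inj₁ (lineIndex-joins p₁ p₂ p₁≢p₂)
∈sides⇒onSquare {_} {p₂} {p₃} (_ , _ , _ , p₂≢p₃ , _) (there (here refl)) = inj₂ (inj₁ (lineIndex-joins p₂ p₃ p₂≢p₃))
∈sides⇒onSquare {_} {_} {p₃} {p₄} (_ , _ , _ , _ , _ , p₃≢p₄) (there (there (here refl))) =
  inj₂ (inj₂ (inj₁ (lineIndex-joins p₃ p₄ p₃≢p₄)))
∈sides⇒onSquare {p₁} {_} {_} {p₄} (_ , _ , p₁≢p₄ , _) (there (there (there (here refl)))) =
  inj₂ (inj₂ (inj₂ (lineIndex-joins p₄ p₁ (p₁≢p₄ ∘ sym))))

distinct4? : ∀ p₁ p₂ p₃ p₄ → Dec (Distinct4 p₁ p₂ p₃ p₄)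
distinct4? p₁ p₂ p₃ p₄ =
  ¬? (p₁ ≟ p₂) ×-dec ¬? (p₁ ≟ p₃) ×-dec ¬? (p₁ ≟ p₄) ×-dec ¬? (p₂ ≟ p₃) ×-dec ¬? (p₂ ≟ p₄) ×-dec ¬? (p₃ ≟ p₄)

SameSides : (Point × Point × Point × Point) → (Point × Point × Point × Point) → Set
SameSides (p₁ , p₂ , p₃ , p₄) (q₁ , q₂ , q₃ , q₄) =
  sides p₁ p₂ p₃ p₄ LineLists.⊆ sides q₁ q₂ q₃ q₄ × sides q₁ q₂ q₃ q₄ LineLists.⊆ sides p₁ p₂ p₃ p₄

-- Every closed walk p₁ p₂ p₃ p₄ p₁ along the lines ls through four distinct points runs along the sides of a b c d.
SquaresAgree : List (Point × Point) → Point → Point → Point → Point → Set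
SquaresAgree ls a b c d = All (λ p₁ → All (λ p₂ → All (λ p₃ → p₁ ≢ p₃ → All (λ p₄ →
    Distinct4 p₁ p₂ p₃ p₄ → p₁ ∈ₗ neighboursOf ls p₄ → SameSides (p₁ , p₂ , p₃ , p₄) (a , b , c , d))
    (neighboursOf ls p₃)) (neighboursOf ls p₂)) (neighboursOf ls p₁)) (allFin 8)

squaresAgree? : ∀ ls a b c d → Dec (SquaresAgree ls a b c d)
squaresAgree? ls a b c d = All.all? (λ p₁ → All.all? (λ p₂ → All.all? (λ p₃ → ¬? (p₁ ≟ p₃) →-dec All.all? (λ p₄ →
    distinct4? p₁ p₂ p₃ p₄ →-dec ((p₁ PointLists.∈? neighboursOf ls p₄) →-dec
      ((sides p₁ p₂ p₃ p₄ LineLists.⊆? sides a b c d) ×-dec (sides a b c d LineLists.⊆? sides p₁ p₂ p₃ p₄))))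
    (neighboursOf ls p₃)) (neighboursOf ls p₂)) (neighboursOf ls p₁)) (allFin 8)

squaresAgree⇒UniqueSquare : ∀ {C a b c d} → ContainsSquare C a b c d → SquaresAgree (edgeList C) a b c d →
  UniqueSquare C a b c d
squaresAgree⇒UniqueSquare {C} {a} {b} {c} {d} sq agree = sq , λ p₁ p₂ p₃ p₄ sq′ k →
    (λ o → ∈sides⇒onSquare (proj₁ sq) (proj₁ (same sq′) (onSquare⇒∈sides k o)))
  , (λ o → ∈sides⇒onSquare (proj₁ sq′) (proj₂ (same sq′) (onSquare⇒∈sides k o)))
  where
  same : ∀ {p₁ p₂ p₃ p₄} → ContainsSquare C p₁ p₂ p₃ p₄ → SameSides (p₁ , p₂ , p₃ , p₄) (a , b , c , d)
  same {p₁} {p₂} {p₃} {p₄} sq′ =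
    All.lookup (All.lookup (All.lookup (All.lookup agree (Membership.∈-allFin p₁)) (adj⇒∈-neighbours {C} p₁~p₂))
      (adj⇒∈-neighbours {C} p₂~p₃) (proj₁ (proj₂ (proj₁ sq′)))) (adj⇒∈-neighbours {C} p₃~p₄) (proj₁ sq′)
      (adj⇒∈-neighbours {C} p₄~p₁)
    where
    p₁~p₂ = proj₁ (square-sides sq′)
    p₂~p₃ = proj₁ (proj₂ (square-sides sq′))
    p₃~p₄ = proj₁ (proj₂ (proj₂ (square-sides sq′)))
    p₄~p₁ = proj₂ (proj₂ (proj₂ (square-sides sq′)))

highCount : Valences → ℕ
highCount v = length (filter (λ p → 2 ℕ.<? lookup v p) (# 0 ∷ # 1 ∷ # 2 ∷ # 3 ∷ []))

Acceptable : Valences → Set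
Acceptable v = highCount v ≡ 3 × (∀ p → lookup v p ≢ 0)

acceptable? : ∀ v → Dec (Acceptable v)
acceptable? v = (highCount v ℕ.≟ 3) ×-dec all? (λ p → ¬? (lookup v p ℕ.≟ 0))

highCount-valences : ∀ C →
  highCount (valences C) ≡ length (filter (λ p → 2 ℕ.<? valence C p) (# 0 ∷ # 1 ∷ # 2 ∷ # 3 ∷ []))
highCount-valences C =
  length-filter-map (λ p → 2 ℕ.<? lookup (valences C) p) (λ p → 2 ℕ.<? valence C p) (λ p → p)
  (λ p → mk⇔ (subst (2 ℕ.<_) (lookup-valences C p)) (subst (2 ℕ.<_) (sym (lookup-valences C p))))
  (# 0 ∷ # 1 ∷ # 2 ∷ # 3 ∷ [])

acceptable⇒ : ∀ C → Acceptable (valences C) → ExactlyThreeHigh C (# 0) (# 1) (# 2) (# 3) × (∀ p → ¬ Omits C p)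
acceptable⇒ C (three , nonzero) =
  trans (sym (highCount-valences C)) three ,
  λ p omits → nonzero p (trans (lookup-valences C p) (Omits⇒valence≡0 omits))

⇒acceptable : ∀ C → ExactlyThreeHigh C (# 0) (# 1) (# 2) (# 3) → (∀ p → ¬ Omits C p) → Acceptable (valences C)
⇒acceptable C three covers =
  trans (highCount-valences C) three ,
  λ p zero → covers p (valence≡0⇒Omits (trans (sym (lookup-valences C p)) zero))

_≟ₛ_ : (S T : Subset 8) → Dec (S ≡ T)
_≟ₛ_ = Vec.≡-dec Bool._≟_

balanced? : ∀ S e → Dec (Balanced S e)
balanced? S (p , q) = lookup S p Bool.≟ lookup S q

-- In the second case the component of # 0 is closed under the lines of C, so C is disconnected unless it is ⊤.
ComponentCertified : LineSet → Set
ComponentCertified C = component C ≡ ⊤ ⊎ (Closed (edgeList C) (component C) × # 0 ∈ component C)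

componentCertified? : ∀ C → Dec (ComponentCertified C)
componentCertified? C =
  (component C ≟ₛ ⊤) ⊎-dec (All.all? (balanced? (component C)) (edgeList C) ×-dec (# 0 ∈ₛ? component C))

connected? : ∀ C → Dec (component C ≡ ⊤)
connected? C = component C ≟ₛ ⊤

T₀ : LineSet
T₀ = squareLines (# 0) (# 1) (# 2) (# 3)

-- Opaque, so that type checking never evaluates these lists except where asked to.
opaque
  candidates : List LineSet
  candidates = supersets (does ∘ acceptable?) T₀ endpointTable 8 (replicate 8 0)

  candidates-unique : Unique candidates
  candidates-unique = supersets-unique (does ∘ acceptable?) T₀ endpointTable 8 (replicate 8 0)

  ∈-candidates⁻ : ∀ {C} → C ∈ₗ candidates →
    T₀ ⊆ C × IsLineComplex C × ExactlyThreeHigh C (# 0) (# 1) (# 2) (# 3) × (∀ p → ¬ Omits C p)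
  ∈-candidates⁻ {C} C∈ =
    let T₀⊆C , size , accepted = supersets-sound (does ∘ acceptable?) T₀ endpointTable 8 (replicate 8 0) C C∈
    in T₀⊆C , size , acceptable⇒ C (does≡true⇒ (acceptable? (valences C)) accepted)

  ∈-candidates⁺ : ∀ {C} → T₀ ⊆ C → IsLineComplex C → ExactlyThreeHigh C (# 0) (# 1) (# 2) (# 3) →
    (∀ p → ¬ Omits C p) → C ∈ₗ candidates
  ∈-candidates⁺ {C} T₀⊆C size three covers =
    subst (λ k → C ∈ₗ supersets (does ∘ acceptable?) T₀ endpointTable k (replicate 8 0)) size
      (supersets-complete (does ∘ acceptable?) T₀ endpointTable (replicate 8 0) C T₀⊆C
        (dec-true (acceptable? (valences C)) (⇒acceptable C three covers)))

  candidates-certified : All ComponentCertified candidates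
  candidates-certified = all-decided componentCertified? candidates _

opaque
  connectedCandidates : List LineSet
  connectedCandidates = filter connected? candidates

  connectedCandidates-unique : Unique connectedCandidates
  connectedCandidates-unique = Unique.filter⁺ connected? {xs = candidates} candidates-unique

  ∈-connectedCandidates⁻ : ∀ {C} → C ∈ₗ connectedCandidates → C ∈ₗ candidates × component C ≡ ⊤
  ∈-connectedCandidates⁻ = Membership.∈-filter⁻ connected? {xs = candidates}

  ∈-connectedCandidates⁺ : ∀ {C} → C ∈ₗ candidates → component C ≡ ⊤ → C ∈ₗ connectedCandidates
  ∈-connectedCandidates⁺ = Membership.∈-filter⁺ connected? {xs = candidates}

opaque
  unfolding candidates connectedCandidates
  connectedCandidates-squaresAgree : All (λ C → SquaresAgree (edgeList C) (# 0) (# 1) (# 2) (# 3)) connectedCandidates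
  connectedCandidates-squaresAgree =
    all-decided (λ C → squaresAgree? (edgeList C) (# 0) (# 1) (# 2) (# 3)) connectedCandidates _

  connectedCandidates-length : length connectedCandidates ≡ 432
  connectedCandidates-length = refl

squareCount : HasCount (Counted (# 0) (# 1) (# 2) (# 3)) 432
squareCount =
  connectedCandidates , connectedCandidates-unique , (λ C → sound C , complete C) , connectedCandidates-length
  where
  sound : ∀ C → C ∈ₗ connectedCandidates → Counted (# 0) (# 1) (# 2) (# 3) C
  sound C C∈ =
    let C∈candidates , component≡⊤ = ∈-connectedCandidates⁻ C∈
        T₀⊆C , size , three , covers = ∈-candidates⁻ C∈candidates
        conn = component≡⊤⇒connected C component≡⊤
        sq : ContainsSquare C (# 0) (# 1) (# 2) (# 3)
        sq = ((λ ()) , (λ ()) , (λ ()) , (λ ()) , (λ ()) , (λ ())) , λ k o → T₀⊆C (onSquare⇒∈squareLines o)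
    in size , conn , (covers , connected-cycle⇒¬IsolatedTree conn (square⇒cycle sq)) ,
       squaresAgree⇒UniqueSquare sq (All.lookup connectedCandidates-squaresAgree C∈) , three
  complete : ∀ C → Counted (# 0) (# 1) (# 2) (# 3) C → C ∈ₗ connectedCandidates
  complete C (size , conn , (covers , _) , (sq , _) , three) =
    let C∈candidates = ∈-candidates⁺ (ContainsSquare⇒⊆ sq) size three covers
    in ∈-connectedCandidates⁺ C∈candidates
         (Sum.[ id , (λ (closed , 0∈) → connected⇒component≡⊤ conn closed 0∈) ]
           (All.lookup candidates-certified C∈candidates))

mainTheorem19 : ∀ (a b c d : Point) → Distinct4 a b c d →
                  HasCount (Counted a b c d) 432
mainTheorem19 a b c d distinct with squarePermutation distinct
... | π , π0≡a , π1≡b , π2≡c , π3≡d =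
  HasCount-transport (π ·_) (flip π ·_)
    (permuteSubset-inverse (linePermutation π)) (permuteSubset-inverse (linePermutation (flip π)))
    (λ counted → Counted-resp π0≡a π1≡b π2≡c π3≡d (Counted-· π counted))
    (λ counted → Counted-resp (back π0≡a) (back π1≡b) (back π2≡c) (back π3≡d) (Counted-· (flip π) counted))
    squareCount
  where
  back : ∀ {x y} → π ⟨$⟩ʳ x ≡ y → π ⟨$⟩ˡ y ≡ x
  back {x} πx≡y = trans (cong (π ⟨$⟩ˡ_) (sym πx≡y)) (inverseˡ π)
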